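{- Let $G$ be a deterministic labeled graph with vertex set $Q$. Then $G$ is synchronizing if and only if for each initial irreducible component $C$ of $G$ there exist (i) a synchronizing word for the subgraph induced by $C$, and (ii) a word separating the subgraph induced by $C$ from the subgraph induced by $Q\setminus C$.
   Context: A labeled graph has a finite vertex set, finite edge set, initial/terminal vertex maps on edges and an edge labeling into a finite alphabet (loops and multiple edges allowed; not necessarily essential). Paths are finite sequences of consecutive edges with concatenated labels; each vertex has an empty path labeled $\epsilon$. $F_G(q)$ is the set of labels of paths starting at $q$. $G$ is deterministic if no vertex has two outgoing edges with the same label; then $q\cdot w$ is the end vertex of the unique path from $q$ labeled $w$ (defined iff $w\in F_G(q)$), and $S\cdot w=\{q\cdot w:q\in S,\ w\in F_G(q)\}$. A word $w$ is synchronizing for $G$ if $Q_G\cdot w=\{r\}$ for a single vertex $r$ (it synchronizes to $r$); $G$ is synchronizing if every vertex $r$ has a word synchronizing to $r$. The subgraph induced by $P\subseteq Q$ has vertex set $P$ and all edges of $G$ with both endpoints in $P$, with the same labels. Irreducible components are the classes of the relation "$p$ and $q$ are reachable from each other by paths"; a component $C$ is initial if whenever $q\in C$ is reachable from $p$, then $p\in C$. A word $w$ separates $G_1$ from $G_2$ if $Q_{G_1}\cdot w\neq\varnothing$ and $Q_{G_2}\cdot w=\varnothing$. -}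

module Defs where

open import Data.Nat using (ℕ)
open import Data.Fin using (Fin)
open import Data.Fin.Subset using (Subset; _∈_; ∁)
open import Data.List using (List; []; _∷_)
open import Data.Product using (Σ; ∃; ∃-syntax; _×_; _,_)
open import Relation.Binary.PropositionalEquality using (_≡_)
open import Relation.Nullary using (¬_)
open import Function.Bundles using (_⇔_)

-- A labeled graph with vertex type V, edge type E and alphabet A.
-- (Finiteness is imposed in the theorem by taking V = Fin n, E = Fin m, A = Fin k.)
record LabeledGraph (V E A : Set) : Set where
  field
    ini   : E → V
    ter   : E → V
    label : E → A
open LabeledGraph public

module _ {V E A : Set} (G : LabeledGraph V E A) where

  data Path : V → List A → V → Set where
    empty : (q : V) → Path q [] q
    step  : {w : List A} {r : V} (e : E) → Path (ter G e) w r → Path (ini G e) (label G e ∷ w) r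

  Deterministic : Set
  Deterministic = (e e′ : E) → ini G e ≡ ini G e′ → label G e ≡ label G e′ → e ≡ e′

  InAct : List A → V → Set
  InAct w r = ∃[ q ] Path q w r

  SynchronizesTo : List A → V → Set
  SynchronizesTo w r = InAct w r × ((r′ : V) → InAct w r′ → r′ ≡ r)

  SynchronizingWord : List A → Set
  SynchronizingWord w = ∃[ r ] SynchronizesTo w r

  Synchronizing : Set
  Synchronizing = (r : V) → ∃[ w ] SynchronizesTo w r

  Reachable : V → V → Set
  Reachable p q = ∃[ w ] Path p w q

  Induced : (P : V → Set) → LabeledGraph (Σ V P) (Σ E (λ e → P (ini G e) × P (ter G e))) A
  Induced P = record
    { ini   = λ { (e , pi , pt) → (ini G e , pi) }
    ; ter   = λ { (e , pi , pt) → (ter G e , pt) }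
    ; label = λ { (e , _) → label G e }
    }

Separates : {V₁ E₁ V₂ E₂ A : Set} → LabeledGraph V₁ E₁ A → LabeledGraph V₂ E₂ A → List A → Set
Separates {V₂ = V₂} G₁ G₂ w = (∃[ r ] InAct G₁ w r) × ((r : V₂) → ¬ InAct G₂ w r)

module _ {n m k : ℕ} (G : LabeledGraph (Fin n) (Fin m) (Fin k)) where

  IrreducibleComponent : Subset n → Set
  IrreducibleComponent C =
    ∃[ q ] ((p : Fin n) → (p ∈ C) ⇔ (Reachable G p q × Reachable G q p))

  InitialComponent : Subset n → Set
  InitialComponent C =
    IrreducibleComponent C × ((p q : Fin n) → q ∈ C → Reachable G p q → p ∈ C)

  InducedOn : (C : Subset n) →
    LabeledGraph (Σ (Fin n) (λ q → q ∈ C))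
                 (Σ (Fin m) (λ e → (ini G e ∈ C) × (ter G e ∈ C))) (Fin k)
  InducedOn C = Induced G (λ q → q ∈ C)

{-# OPTIONS --safe #-}
module Submission where

-- An initial component C is closed under predecessors and Q ∖ C under successors.
-- If a word w synchronizes G to a vertex q ∈ C, every run of w ending in C runs
-- inside C, so w synchronizes C; and no run of w ends in Q ∖ C, so w separates.
-- Conversely, every vertex r is reachable from some initial component C (follow
-- strictly shrinking predecessor sets; reachability is decidable in a finite graph).
-- Let w synchronize C to s, let u separate C from Q ∖ C, let x lead from s to the
-- start of a run of u in C and y from its end to r. In any run of w x u y the
-- factor u is read from a vertex of C, hence so is everything before it; thus the
-- run reads w inside C and reaches s, after which determinism forces it to r.

open import Defs
open import Data.Bool.Properties using (T-≡)
open import Data.Nat using (ℕ)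
open import Data.Fin using (Fin)
open import Data.Fin.Subset using (Subset; ∁; _∈_; _⊆_; _⊂_; _⊃_; _∪_; ⁅_⁆)
open import Data.Fin.Subset.Properties
  using (_∈?_; x∈∁p⇒x∉p; x∉p⇒x∈∁p; x∈p⇒x∉∁p; x∉∁p⇒x∈p; p⊆p∪q; x∈p∪q⁺; x∈p∪q⁻; x∈⁅x⁆; x∈⁅y⁆⇒x≡y)
open import Data.Fin.Subset.Induction using (⊂-wellFounded; ⊃-wellFounded)
open import Data.Fin.Properties using (any?)
open import Data.Vec using (tabulate; here; there)
open import Data.Vec.Properties using ([]=⇒lookup; lookup⇒[]=; lookup∘tabulate)
open import Data.List using ([]; _∷_; _++_)
open import Data.List.Properties using (∷-injectiveˡ; ∷-injectiveʳ)
open import Data.Product using (Σ; ∃-syntax; _×_; _,_; proj₁; proj₂)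
open import Data.Sum using (inj₁; inj₂)
open import Function using (_∘_)
open import Function.Bundles using (_⇔_; mk⇔; Equivalence)
open import Level using (Level)
open import Relation.Binary.PropositionalEquality using (_≡_; refl; sym; trans; cong)
open import Relation.Nullary using (¬_; Dec; yes; no; ¬?)
open import Relation.Nullary.Decidable using (isYes; _×-dec_; toWitness; fromWitness; decidable-stable)
open import Relation.Nullary.Irrelevant using (Irrelevant)
open import Relation.Unary using (Pred; Decidable)
open import Induction.WellFounded using (Acc; acc)

private
  variable
    ℓ : Level
    n : ℕ

∈-irrelevant : {x : Fin n} {S : Subset n} → Irrelevant (x ∈ S)
∈-irrelevant here      here      = refl
∈-irrelevant (there p) (there q) = cong there (∈-irrelevant p q)

toSubset : {P : Pred (Fin n) ℓ} → Decidable P → Subset n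
toSubset P? = tabulate (λ x → isYes (P? x))

∈-toSubset : {P : Pred (Fin n) ℓ} (P? : Decidable P) {x : Fin n} → x ∈ toSubset P? ⇔ P x
∈-toSubset P? {x} = mk⇔
  (λ x∈ → toWitness (Equivalence.from T-≡ (trans (sym lookup-x) ([]=⇒lookup x∈))))
  (λ px → lookup⇒[]= x _ (trans lookup-x (Equivalence.to T-≡ (fromWitness px))))
  where lookup-x = lookup∘tabulate (λ y → isYes (P? y)) x

module Paths {V E A : Set} (G : LabeledGraph V E A) where

  _++ᴾ_ : ∀ {a b c xs ys} → Path G a xs b → Path G b ys c → Path G a (xs ++ ys) c
  empty _  ++ᴾ π′ = π′
  step e π ++ᴾ π′ = step e (π ++ᴾ π′)

  splitᴾ : ∀ xs {ys a c} → Path G a (xs ++ ys) c → ∃[ b ] Path G a xs b × Path G b ys c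
  splitᴾ []       π          = _ , empty _ , π
  splitᴾ (x ∷ xs) (step e π) with splitᴾ xs π
  ... | b , π₁ , π₂ = b , step e π₁ , π₂

  reachable-refl : ∀ {a} → Reachable G a a
  reachable-refl = [] , empty _

  reachable-trans : ∀ {a b c} → Reachable G a b → Reachable G b c → Reachable G a c
  reachable-trans (xs , π) (ys , π′) = xs ++ ys , π ++ᴾ π′

  edge-reachable : ∀ e → Reachable G (ini G e) (ter G e)
  edge-reachable e = _ , step e (empty _)

  target-unique : Deterministic G → ∀ {a a′ w b b′} →
    a ≡ a′ → Path G a w b → Path G a′ w b′ → b ≡ b′
  target-unique det a≡a′ π π′ = go π π′ a≡a′ refl
    where
    go : ∀ {a a′ w w′ b b′} → Path G a w b → Path G a′ w′ b′ → a ≡ a′ → w ≡ w′ → b ≡ b′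
    go (empty _)  (empty _)    a≡a′ _  = a≡a′
    go (step e π) (step e′ π′) a≡a′ w≡w′ with det e e′ a≡a′ (∷-injectiveˡ w≡w′)
    ... | refl = go π π′ refl (∷-injectiveʳ w≡w′)

  BackwardClosed : (V → Set) → Set
  BackwardClosed P = ∀ e → P (ter G e) → P (ini G e)

  ForwardClosed : (V → Set) → Set
  ForwardClosed P = ∀ e → P (ini G e) → P (ter G e)

  module _ {P : V → Set} where

    lift-path : ∀ {a w b} → Path (Induced G P) a w b → Path G (proj₁ a) w (proj₁ b)
    lift-path (empty _)      = empty _
    lift-path (step (e , _) π) = step e (lift-path π)

    restrict-path-backward : BackwardClosed P → ∀ {a w b} → Path G a w b → (pb : P b) →
      Σ (P a) λ pa → Path (Induced G P) (a , pa) w (b , pb)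
    restrict-path-backward closed (empty _)  pb = pb , empty _
    restrict-path-backward closed (step e π) pb with restrict-path-backward closed π pb
    ... | pt , π′ = closed e pt , step (e , closed e pt , pt) π′

    restrict-path-forward : ForwardClosed P → ∀ {a w b} → Path G a w b → (pa : P a) →
      Σ (P b) λ pb → Path (Induced G P) (a , pa) w (b , pb)
    restrict-path-forward closed (empty _)  pa = pa , empty _
    restrict-path-forward closed (step e π) pa with restrict-path-forward closed π (closed e pa)
    ... | pb , π′ = pb , step (e , pa , closed e pa) π′

    backward-closed-path : BackwardClosed P → ∀ {a w b} → Path G a w b → P b → P a
    backward-closed-path closed π = proj₁ ∘ restrict-path-backward closed π

    forward-closed-path : ForwardClosed P → ∀ {a w b} → Path G a w b → P a → P b
    forward-closed-path closed π = proj₁ ∘ restrict-path-forward closed π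

    synchronizes-restrict : (∀ {v} → Irrelevant (P v)) → BackwardClosed P →
      ∀ {w q} → SynchronizesTo G w q → (pq : P q) → SynchronizesTo (Induced G P) w (q , pq)
    synchronizes-restrict irrelevant closed ((a , π) , sync) pq =
      ((a , proj₁ restricted) , proj₂ restricted) , unique
      where
      restricted = restrict-path-backward closed π pq
      unique : ∀ r → InAct (Induced G P) _ r → r ≡ (_ , pq)
      unique (r , pr) (a′ , π′) with sync r (proj₁ a′ , lift-path π′)
      ... | refl = cong (r ,_) (irrelevant pr pq)

    synchronizes-outside : ∀ {w q} → SynchronizesTo G w q → ¬ P q →
      ∀ r → ¬ InAct (Induced G P) w r
    synchronizes-outside (_ , sync) ¬pq (r , pr) (a , π) with sync r (proj₁ a , lift-path π)
    ... | refl = ¬pq pr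

    synchronized-target : BackwardClosed P → ∀ {w s a b} →
      SynchronizesTo (Induced G P) w s → Path G a w b → P b → b ≡ proj₁ s
    synchronized-target closed (_ , sync) π pb with restrict-path-backward closed π pb
    ... | pa , π′ = cong proj₁ (sync (_ , pb) ((_ , pa) , π′))

    separated-start : ForwardClosed P → ∀ {u d e} →
      (∀ r → ¬ InAct (Induced G P) u r) → Path G d u e → ¬ P d
    separated-start closed separated π pd with restrict-path-forward closed π pd
    ... | pe , π′ = separated (_ , pe) ((_ , pd) , π′)

module _ {m k : ℕ} (G : LabeledGraph (Fin n) (Fin m) (Fin k)) where

  open Paths G

  private
    variable
      C : Subset n
      x y : Fin n

  irreducible-connected : IrreducibleComponent G C → x ∈ C → y ∈ C → Reachable G x y
  irreducible-connected (_ , class) x∈C y∈C =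
    reachable-trans (proj₁ (Equivalence.to (class _) x∈C)) (proj₂ (Equivalence.to (class _) y∈C))

  initial⇒backward-closed : InitialComponent G C → BackwardClosed (_∈ C)
  initial⇒backward-closed (_ , initial) e t∈C = initial _ _ t∈C (edge-reachable e)

  complement-forward-closed : BackwardClosed (_∈ C) → ForwardClosed (_∈ ∁ C)
  complement-forward-closed closed e i∈∁C =
    x∉p⇒x∈∁p λ t∈C → x∈∁p⇒x∉p i∈∁C (closed e t∈C)

  -- Add the target of an edge leaving S until none is left; S grows strictly each time.
  reachable-closure : ∀ {p} S → Acc _⊃_ S → (∀ {x} → x ∈ S → Reachable G p x) →
    ∃[ T ] S ⊆ T × ForwardClosed (_∈ T) × (∀ {x} → x ∈ T → Reachable G p x)
  reachable-closure S (acc rec) reach with any? (λ e → ini G e ∈? S ×-dec ¬? (ter G e ∈? S))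
  ... | no no-exit = S , (λ x∈S → x∈S) , closed , reach
    where
    closed : ForwardClosed (_∈ S)
    closed e i∈S = decidable-stable (ter G e ∈? S) λ t∉S → no-exit (e , i∈S , t∉S)
  ... | yes (e , i∈S , t∉S) with reachable-closure S′ (rec S⊂S′) reach′
    where
    S′ = S ∪ ⁅ ter G e ⁆
    S⊂S′ : S ⊂ S′
    S⊂S′ = p⊆p∪q _ , ter G e , x∈p∪q⁺ (inj₂ (x∈⁅x⁆ _)) , t∉S
    reach′ : ∀ {x} → x ∈ S′ → Reachable G _ x
    reach′ x∈S′ with x∈p∪q⁻ S _ x∈S′
    ... | inj₁ x∈S = reach x∈S
    ... | inj₂ x∈t with x∈⁅y⁆⇒x≡y _ x∈t
    ... | refl = reachable-trans (reach i∈S) (edge-reachable e)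
  ... | T , S′⊆T , closed , reach-T = T , S′⊆T ∘ p⊆p∪q _ , closed , reach-T

  reachable? : ∀ p q → Dec (Reachable G p q)
  reachable? p q with reachable-closure ⁅ p ⁆ (⊃-wellFounded _) from-p
    where
    from-p : ∀ {x} → x ∈ ⁅ p ⁆ → Reachable G p x
    from-p x∈⁅p⁆ with x∈⁅y⁆⇒x≡y p x∈⁅p⁆
    ... | refl = reachable-refl
  ... | T , ⁅p⁆⊆T , closed , reach with q ∈? T
  ... | yes q∈T = yes (reach q∈T)
  ... | no  q∉T = no λ (_ , π) → q∉T (forward-closed-path closed π (⁅p⁆⊆T (x∈⁅x⁆ p)))

  predecessors : Fin n → Subset n
  predecessors p = toSubset (λ q → reachable? q p)

  component : Fin n → Subset n
  component p = toSubset (λ q → reachable? q p ×-dec reachable? p q)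

  component-initial : ∀ {p} → (∀ q → Reachable G q p → Reachable G p q) →
    InitialComponent G (component p)
  component-initial {p} sources = (p , λ q → ∈-toSubset _) , initial
    where
    initial : ∀ q r → r ∈ component p → Reachable G q r → q ∈ component p
    initial q r r∈C q⇝r = Equivalence.from (∈-toSubset _) (q⇝p , sources q q⇝p)
      where q⇝p = reachable-trans q⇝r (proj₁ (Equivalence.to (∈-toSubset _) r∈C))

  initial-component-above : ∀ p → ∃[ C ] InitialComponent G C × ∃[ c ] c ∈ C × Reachable G c p
  initial-component-above p = go p (⊂-wellFounded (predecessors p))
    where
    go : ∀ p → Acc _⊂_ (predecessors p) →
      ∃[ C ] InitialComponent G C × ∃[ c ] c ∈ C × Reachable G c p
    go p (acc rec) with any? (λ q → reachable? q p ×-dec ¬? (reachable? p q))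
    ... | no none = component p , component-initial sources , p ,
                    Equivalence.from (∈-toSubset _) (reachable-refl , reachable-refl) ,
                    reachable-refl
      where
      sources : ∀ q → Reachable G q p → Reachable G p q
      sources q q⇝p = decidable-stable (reachable? p q) λ p↛q → none (q , q⇝p , p↛q)
    ... | yes (q , q⇝p , p↛q) with go q (rec fewer)
      where
      fewer : predecessors q ⊂ predecessors p
      fewer = (λ x∈ → Equivalence.from (∈-toSubset _)
                        (reachable-trans (Equivalence.to (∈-toSubset _) x∈) q⇝p)) ,
              p , Equivalence.from (∈-toSubset _) reachable-refl ,
              λ p∈ → p↛q (Equivalence.to (∈-toSubset _) p∈)
    ... | C , initial , c , c∈C , c⇝q = C , initial , c , c∈C , reachable-trans c⇝q q⇝p

  SynchronizingAndSeparated : Subset n → Set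
  SynchronizingAndSeparated C =
    (∃[ w ] SynchronizingWord (InducedOn G C) w) ×
    (∃[ u ] Separates (InducedOn G C) (InducedOn G (∁ C)) u)

  synchronizing⇒synchronizing-and-separated :
    Synchronizing G → InitialComponent G C → SynchronizingAndSeparated C
  synchronizing⇒synchronizing-and-separated sync initial@((q , class) , _)
    with sync q
  ... | w , sync-q =
    (w , (q , q∈C) , sync-C) , (w , (_ , proj₁ sync-C) , synchronizes-outside sync-q (x∈p⇒x∉∁p q∈C))
    where
    q∈C = Equivalence.from (class q) (reachable-refl , reachable-refl)
    sync-C = synchronizes-restrict ∈-irrelevant (initial⇒backward-closed initial) sync-q q∈C

  synchronizes-via-separation : Deterministic G → BackwardClosed (_∈ C) →
    ∀ {w u x y s d e r} →
    SynchronizesTo (InducedOn G C) w s → (∀ r → ¬ InAct (InducedOn G (∁ C)) u r) →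
    Path G (proj₁ s) x d → Path G d u e → Path G e y r →
    SynchronizesTo G (w ++ x ++ u ++ y) r
  synchronizes-via-separation det closed {w} {u} {x} sync-w separated π-x π-u π-y
    with proj₁ sync-w
  ... | a , π-w = (proj₁ a , lift-path π-w ++ᴾ (π-x ++ᴾ (π-u ++ᴾ π-y))) , unique
    where
    unique : ∀ r′ → InAct G _ r′ → r′ ≡ _
    unique r′ (_ , π) with splitᴾ w π
    ... | b′ , π-w′ , π₁ with splitᴾ x π₁
    ... | d′ , π-x′ , π₂ with splitᴾ u π₂
    ... | e′ , π-u′ , π-y′ = target-unique det e′≡e π-y′ π-y
      where
      d′∈C = x∉∁p⇒x∈p (separated-start (complement-forward-closed closed) separated π-u′)
      b′≡s = synchronized-target closed sync-w π-w′ (backward-closed-path closed π-x′ d′∈C)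
      e′≡e = target-unique det (target-unique det b′≡s π-x′ π-x) π-u′ π-u

  synchronizing-and-separated⇒synchronizing : Deterministic G →
    (∀ C → InitialComponent G C → SynchronizingAndSeparated C) → Synchronizing G
  synchronizing-and-separated⇒synchronizing det components r
    with initial-component-above r
  ... | C , initial@(irreducible , _) , c , c∈C , (_ , π-c)
    with components C initial
  ... | (_ , s , sync) , (_ , (e , d , π-u) , separated)
    with irreducible-connected irreducible (proj₂ s) (proj₂ d)
       | irreducible-connected irreducible (proj₂ e) c∈C
  ... | _ , π-x | _ , π-e =
    _ , synchronizes-via-separation det (initial⇒backward-closed initial) sync separated
          π-x (lift-path π-u) (π-e ++ᴾ π-c)

theorem3p3 : {n m k : ℕ} (G : LabeledGraph (Fin n) (Fin m) (Fin k)) → Deterministic G →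
    Synchronizing G ⇔
      ((C : Subset n) → InitialComponent G C →
        (∃[ w ] SynchronizingWord (InducedOn G C) w)
          × (∃[ u ] Separates (InducedOn G C) (InducedOn G (∁ C)) u))
theorem3p3 G det = mk⇔
  (λ sync _ → synchronizing⇒synchronizing-and-separated G sync)
  (synchronizing-and-separated⇒synchronizing G det)
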